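{- Let $n \ge 1$, let $\pi$ and $\tau$ be permutations of $\{1, \ldots, n^2\}$ and let $x = (x_1, \ldots, x_{n^2})^T \in \mathbb{Z}^{n^2}$. The following are equivalent: (i) $A_\pi \tau(x) <> \mathbf{0}$; (ii) for each $j = 1, \ldots, n$, the numbers $x_{(\pi\circ\tau^{ -1})((j-1)n+1)}, \ldots, x_{(\pi\circ\tau^{ -1})(jn)}$ are pairwise distinct.
   Context: For $y \in \mathbb{Z}^s$ write $y <> \mathbf{0}$ if every component of $y$ is nonzero. Let $s(n) = \sum_{i=1}^{n-1} i$. The $s(n) \times n$ matrix $A(n)$ is defined inductively: $A(1)$ is the empty matrix, and $A(n) = \begin{pmatrix} \mathbf{1}_{n-1} & -U_{n-1} \\ \mathbf{0}_{s(n-1)} & A(n-1) \end{pmatrix}$, where $\mathbf{1}_{n-1}$ is the all-ones column, $U_{n-1}$ the identity matrix and $\mathbf{0}_{s(n-1)}$ the zero column of length $s(n-1)$. Let $A$ be the $(n \cdot s(n)) \times n^2$ block-diagonal matrix whose $n$ diagonal blocks all equal $A(n)$. For a permutation $\pi$ of $\{1,\ldots,n^2\}$, $A_\pi$ is the matrix whose $j$-th column is the $\pi^{ -1}(j)$-th column of $A$. For a permutation $\tau$ of $\{1,\ldots,n^2\}$ and $x \in \mathbb{Z}^{n^2}$, $\tau(x) = (x_{\tau^{ -1}(1)}, \ldots, x_{\tau^{ -1}(n^2)})^T$. -}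

module Defs where

open import Data.Nat using (ℕ; zero; suc) renaming (_+_ to _+ℕ_; _*_ to _*ℕ_)
open import Data.Integer using (ℤ; 0ℤ; 1ℤ; -1ℤ; _+_; _*_)
open import Data.Fin using (Fin; zero; suc)
open import Data.Fin.Permutation using (Permutation′; _⟨$⟩ˡ_)
open import Data.Vec using (Vec; []; _∷_; map; tabulate; lookup; replicate; zipWith; foldr; _++_)

Matrix : ℕ → ℕ → Set
Matrix m k = Vec (Vec ℤ k) m

s : ℕ → ℕ
s zero    = zero
s (suc n) = n +ℕ s n

e : ∀ {k} → Fin k → Vec ℤ k
e {k} i = tabulate (λ j → δ i j)
  where
  δ : ∀ {k} → Fin k → Fin k → ℤ
  δ zero    zero    = 1ℤ
  δ zero    (suc _) = 0ℤ
  δ (suc _) zero    = 0ℤ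
  δ (suc i) (suc j) = δ i j

negId : (k : ℕ) → Matrix k k
negId k = tabulate (λ i → map (λ z → -1ℤ * z) (e i))

-- A(n), an s(n) × n matrix; A(0) is the (irrelevant) empty 0×0 matrix
A : (n : ℕ) → Matrix (s n) n
A zero          = []
A (suc zero)    = []
A (suc (suc n)) =
  map (1ℤ ∷_) (negId (suc n)) ++ map (0ℤ ∷_) (A (suc n))

blockDiag : ∀ {r c} (k : ℕ) → Matrix r c → Matrix (k *ℕ r) (k *ℕ c)
blockDiag zero M = []
blockDiag {r} {c} (suc k) M =
  map (_++ replicate (k *ℕ c) 0ℤ) M ++ map (replicate c 0ℤ ++_) (blockDiag k M)

bigA : (n : ℕ) → Matrix (n *ℕ s n) (n *ℕ n)
bigA n = blockDiag n (A n)

-- A_π : j-th column is the π⁻¹(j)-th column of M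
permCols : ∀ {m k} → Permutation′ k → Matrix m k → Matrix m k
permCols π M = map (λ row → tabulate (λ j → lookup row (π ⟨$⟩ˡ j))) M

-- τ(x) = (x_{τ⁻¹(1)}, …, x_{τ⁻¹(N)})
permVec : ∀ {k} → Permutation′ k → Vec ℤ k → Vec ℤ k
permVec τ x = tabulate (λ i → lookup x (τ ⟨$⟩ˡ i))

mulVec : ∀ {m k} → Matrix m k → Vec ℤ k → Vec ℤ m
mulVec M v = map (λ row → foldr _ _+_ 0ℤ (zipWith _*_ row v)) M

module Submission where

-- Permuting the columns of a matrix by π and the vector by
--    τ gives the same product as the original matrix applied to the vector
--    z = (x_{(π∘τ⁻¹)(c)})_c, since a dot product is invariant under a
--    simultaneous permutation of both factors.
--  * The matrices A(n).  The rows of A(n) applied to w are exactly the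
--    differences w_i - w_{i'} with i < i', so A(n)w has no zero entry iff the
--    entries of w are pairwise distinct; we say A(n) "detects repetitions".
--  * Block diagonals.  If M detects repetitions, then the block diagonal
--    matrix with k copies of M is nonvanishing on v iff each of the k blocks
--    of v has pairwise distinct entries.

open import Defs
open import Data.Nat using (ℕ; _≤_; _*_; zero; suc)
open import Data.Integer using (ℤ; 0ℤ; 1ℤ; -1ℤ; -_; _-_) renaming (_+_ to _+ℤ_; _*_ to _*ℤ_)
import Data.Integer.Properties as ℤ
open import Data.Fin using (Fin; combine; zero; suc)
open import Data.Fin.Properties using (suc-injective)
open import Data.Fin.Permutation using (Permutation′; _⟨$⟩ʳ_; _⟨$⟩ˡ_; _∘ₚ_; flip; inverseʳ)
open import Data.Vec using (Vec; lookup; []; _∷_; map; tabulate; foldr; zipWith; _++_; splitAt; replicate)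
open import Data.Vec.Properties
  using (lookup∘tabulate; tabulate∘lookup; tabulate-∘; tabulate-cong; map-++; map-cong; map-id; lookup-++ˡ; lookup-++ʳ)
open import Data.Vec.Relation.Unary.All using (All; []; _∷_)
import Data.Vec.Relation.Unary.All.Properties as All
open import Data.Product using (_×_; _,_; uncurry)
open import Data.Product.Function.NonDependent.Propositional using (_×-⇔_)
open import Data.Empty using (⊥-elim)
open import Function using (_∘_)
open import Function.Bundles using (_⇔_; mk⇔; module Equivalence)
open import Function.Properties.Equivalence using () renaming (trans to ⇔-trans; sym to ⇔-sym)
open import Relation.Binary.PropositionalEquality
  using (_≢_; _≡_; _≗_; refl; sym; trans; cong; cong₂; subst₂; module ≡-Reasoning)
open import Algebra.Properties.CommutativeMonoid.Sum ℤ.+-0-commutativeMonoid using (sum; sum-cong-≗; sum-permute)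

open ≡-Reasoning

dot : ∀ {k} → Vec ℤ k → Vec ℤ k → ℤ
dot u v = foldr _ _+ℤ_ 0ℤ (zipWith _*ℤ_ u v)

Nonvanishing : ∀ {m} → Vec ℤ m → Set
Nonvanishing = All (_≢ 0ℤ)

-- dot as a monoid sum, so that sums can be reindexed by a permutation.
dot-sum : ∀ {k} (u v : Vec ℤ k) → dot u v ≡ sum (λ i → lookup u i *ℤ lookup v i)
dot-sum []      []      = refl
dot-sum (a ∷ u) (b ∷ v) = cong (a *ℤ b +ℤ_) (dot-sum u v)

dot-++ : ∀ {a b} (u w : Vec ℤ a) (u′ w′ : Vec ℤ b) → dot (u ++ u′) (w ++ w′) ≡ dot u w +ℤ dot u′ w′
dot-++ []      []      u′ w′ = sym (ℤ.+-identityˡ _)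
dot-++ (p ∷ u) (q ∷ w) u′ w′ = trans (cong (p *ℤ q +ℤ_) (dot-++ u w u′ w′)) (sym (ℤ.+-assoc (p *ℤ q) _ _))

dot-zeroˡ : ∀ {a} {u : Vec ℤ a} → All (_≡ 0ℤ) u → (w : Vec ℤ a) → dot u w ≡ 0ℤ
dot-zeroˡ []           []      = refl
dot-zeroˡ (refl ∷ u≡0) (q ∷ w) = trans (ℤ.+-identityˡ _) (dot-zeroˡ u≡0 w)

zeros : ∀ a → All (_≡ 0ℤ) (replicate a 0ℤ)
zeros zero    = []
zeros (suc a) = refl ∷ zeros a

dot-permute : ∀ {k} (ρ : Permutation′ k) (u v : Vec ℤ k) → dot (permVec ρ u) (permVec ρ v) ≡ dot u v
dot-permute {k} ρ u v = begin
  dot (permVec ρ u) (permVec ρ v)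
    ≡⟨ dot-sum (permVec ρ u) (permVec ρ v) ⟩
  sum (λ j → lookup (permVec ρ u) j *ℤ lookup (permVec ρ v) j)
    ≡⟨ sum-cong-≗ {k} (λ j → cong₂ _*ℤ_ (lookup∘tabulate _ j) (lookup∘tabulate _ j)) ⟩
  sum (λ j → lookup u (ρ ⟨$⟩ˡ j) *ℤ lookup v (ρ ⟨$⟩ˡ j))
    ≡⟨ sum-permute (λ i → lookup u i *ℤ lookup v i) (flip ρ) ⟨
  sum (λ i → lookup u i *ℤ lookup v i)
    ≡⟨ dot-sum u v ⟨
  dot u v ∎

permVec-flip : ∀ {k} (π : Permutation′ k) (v : Vec ℤ k) → permVec π (permVec (flip π) v) ≡ v
permVec-flip π v = trans
  (tabulate-cong (λ j → trans (lookup∘tabulate _ (π ⟨$⟩ˡ j)) (cong (lookup v) (inverseʳ π))))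
  (tabulate∘lookup v)

mulVec-permCols : ∀ {m k} (π : Permutation′ k) (M : Matrix m k) (v : Vec ℤ k) →
  mulVec (permCols π M) v ≡ mulVec M (permVec (flip π) v)
mulVec-permCols π []      v = refl
mulVec-permCols π (r ∷ M) v = cong₂ _∷_ row (mulVec-permCols π M v)
  where
  row : dot (permVec π r) v ≡ dot r (permVec (flip π) v)
  row = trans (cong (dot (permVec π r)) (sym (permVec-flip π v))) (dot-permute π r _)

-- The vector seen by the unpermuted matrix in the theorem.
lookup-permVec-permVec : ∀ {k} (π τ : Permutation′ k) (x : Vec ℤ k) (c : Fin k) →
  lookup (permVec (flip π) (permVec τ x)) c ≡ lookup x ((π ∘ₚ flip τ) ⟨$⟩ʳ c)
lookup-permVec-permVec π τ x c =
  trans (lookup∘tabulate _ c) (lookup∘tabulate (λ i → lookup x (τ ⟨$⟩ˡ i)) (π ⟨$⟩ʳ c))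

Distinct : ∀ {A : Set} {c} → (Fin c → A) → Set
Distinct f = ∀ i i′ → i ≢ i′ → f i ≢ f i′

BlockDistinct : ∀ {A : Set} k c → (Fin (k * c) → A) → Set
BlockDistinct k c f = (j : Fin k) → Distinct (λ i → f (combine j i))

Distinct-resp : ∀ {A : Set} {c} {f g : Fin c → A} → f ≗ g → Distinct f → Distinct g
Distinct-resp f≗g d i i′ i≢i′ = subst₂ _≢_ (f≗g i) (f≗g i′) (d i i′ i≢i′)

BlockDistinct-resp : ∀ {A : Set} {k c} {f g : Fin (k * c) → A} → f ≗ g → BlockDistinct k c f → BlockDistinct k c g
BlockDistinct-resp f≗g d j = Distinct-resp (f≗g ∘ combine j) (d j)

distinct-singleton : ∀ {A : Set} (f : Fin 1 → A) → Distinct f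
distinct-singleton f zero zero 0≢0 = ⊥-elim (0≢0 refl)

Distinct-suc : ∀ {A : Set} {c} (f : Fin (suc c) → A) →
  Distinct f ⇔ ((∀ i → f zero ≢ f (suc i)) × Distinct (f ∘ suc))
Distinct-suc f = mk⇔
  (λ d → (λ i → d zero (suc i) (λ ())) , (λ i i′ i≢i′ → d (suc i) (suc i′) (i≢i′ ∘ suc-injective)))
  (uncurry from)
  where
  from : (∀ i → f zero ≢ f (suc i)) → Distinct (f ∘ suc) → Distinct f
  from new d zero     zero      0≢0 = ⊥-elim (0≢0 refl)
  from new d zero     (suc i′)  _   = new i′
  from new d (suc i)  zero      _   = new i ∘ sym
  from new d (suc i)  (suc i′)  ne  = d i i′ (ne ∘ cong suc)

BlockDistinct-++ : ∀ {A : Set} {k c} (w : Vec A c) (v : Vec A (k * c)) →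
  BlockDistinct (suc k) c (lookup (w ++ v)) ⇔ (Distinct (lookup w) × BlockDistinct k c (lookup v))
BlockDistinct-++ {k = k} w v = mk⇔
  (λ d → Distinct-resp first (d zero) , λ j → Distinct-resp (rest j) (d (suc j)))
  (λ { (dw , dv) zero    → Distinct-resp (sym ∘ first) dw
     ; (dw , dv) (suc j) → Distinct-resp (sym ∘ rest j) (dv j) })
  where
  first : ∀ i → lookup (w ++ v) (combine {suc k} zero i) ≡ lookup w i
  first = lookup-++ˡ w v
  rest : ∀ j i → lookup (w ++ v) (combine {suc k} (suc j) i) ≡ lookup v (combine j i)
  rest j i = lookup-++ʳ w v (combine j i)

DetectsRepetition : ∀ {r c} → Matrix r c → Set
DetectsRepetition {c = c} M = (w : Vec ℤ c) → Nonvanishing (mulVec M w) ⇔ Distinct (lookup w)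

Nonvanishing-++ : ∀ {a b} (u : Vec ℤ a) (v : Vec ℤ b) → Nonvanishing (u ++ v) ⇔ (Nonvanishing u × Nonvanishing v)
Nonvanishing-++ u v = mk⇔ (All.++⁻ u) (uncurry All.++⁺)

mulVec-++ : ∀ {r r′ c} (M : Matrix r c) (N : Matrix r′ c) (v : Vec ℤ c) →
  mulVec (M ++ N) v ≡ mulVec M v ++ mulVec N v
mulVec-++ M N v = map-++ (λ row → dot row v) M N

mulVec-padʳ : ∀ {r c d} (M : Matrix r c) (w : Vec ℤ c) (v : Vec ℤ d) →
  mulVec (map (_++ replicate d 0ℤ) M) (w ++ v) ≡ mulVec M w
mulVec-padʳ []      w v = refl
mulVec-padʳ {d = d} (r ∷ M) w v = cong₂ _∷_ row (mulVec-padʳ M w v)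
  where
  row : dot (r ++ replicate d 0ℤ) (w ++ v) ≡ dot r w
  row = begin
    dot (r ++ replicate d 0ℤ) (w ++ v) ≡⟨ dot-++ r w (replicate d 0ℤ) v ⟩
    dot r w +ℤ dot (replicate d 0ℤ) v  ≡⟨ cong (dot r w +ℤ_) (dot-zeroˡ (zeros d) v) ⟩
    dot r w +ℤ 0ℤ                      ≡⟨ ℤ.+-identityʳ (dot r w) ⟩
    dot r w                            ∎

mulVec-padˡ : ∀ {r c d} (N : Matrix r d) (w : Vec ℤ c) (v : Vec ℤ d) →
  mulVec (map (replicate c 0ℤ ++_) N) (w ++ v) ≡ mulVec N v
mulVec-padˡ []      w v = refl
mulVec-padˡ {c = c} (r ∷ N) w v = cong₂ _∷_ row (mulVec-padˡ N w v)
  where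
  row : dot (replicate c 0ℤ ++ r) (w ++ v) ≡ dot r v
  row = begin
    dot (replicate c 0ℤ ++ r) (w ++ v) ≡⟨ dot-++ (replicate c 0ℤ) w r v ⟩
    dot (replicate c 0ℤ) w +ℤ dot r v  ≡⟨ cong (_+ℤ dot r v) (dot-zeroˡ (zeros c) w) ⟩
    0ℤ +ℤ dot r v                      ≡⟨ ℤ.+-identityˡ (dot r v) ⟩
    dot r v                            ∎

mulVec-blockDiag : ∀ {r c} k (M : Matrix r c) (w : Vec ℤ c) (v : Vec ℤ (k * c)) →
  mulVec (blockDiag (suc k) M) (w ++ v) ≡ mulVec M w ++ mulVec (blockDiag k M) v
mulVec-blockDiag {c = c} k M w v = begin
  mulVec (map (_++ replicate (k * c) 0ℤ) M ++ map (replicate c 0ℤ ++_) (blockDiag k M)) (w ++ v)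
    ≡⟨ mulVec-++ (map (_++ replicate (k * c) 0ℤ) M) (map (replicate c 0ℤ ++_) (blockDiag k M)) (w ++ v) ⟩
  mulVec (map (_++ replicate (k * c) 0ℤ) M) (w ++ v) ++ mulVec (map (replicate c 0ℤ ++_) (blockDiag k M)) (w ++ v)
    ≡⟨ cong₂ _++_ (mulVec-padʳ M w v) (mulVec-padˡ (blockDiag k M) w v) ⟩
  mulVec M w ++ mulVec (blockDiag k M) v ∎

blockDiag-detects : ∀ {r c} {M : Matrix r c} → DetectsRepetition M →
  ∀ k (v : Vec ℤ (k * c)) → Nonvanishing (mulVec (blockDiag k M) v) ⇔ BlockDistinct k c (lookup v)
blockDiag-detects det zero    [] = mk⇔ (λ _ ()) (λ _ → [])
blockDiag-detects {c = c} {M} det (suc k) v with splitAt c v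
... | w , v′ , refl rewrite mulVec-blockDiag k M w v′ =
  ⇔-trans (Nonvanishing-++ (mulVec M w) (mulVec (blockDiag k M) v′))
    (⇔-trans (det w ×-⇔ blockDiag-detects det k v′) (⇔-sym (BlockDistinct-++ w v′)))

mulVec-consCol : ∀ {r k} (c : ℤ) (M : Matrix r k) (a : ℤ) (w : Vec ℤ k) →
  mulVec (map (c ∷_) M) (a ∷ w) ≡ map (c *ℤ a +ℤ_) (mulVec M w)
mulVec-consCol c []      a w = refl
mulVec-consCol c (r ∷ M) a w = cong (_ ∷_) (mulVec-consCol c M a w)

dot-negUnit : ∀ {k} (i : Fin k) (w : Vec ℤ k) → dot (map (-1ℤ *ℤ_) (e i)) w ≡ - lookup w i
dot-negUnit zero    (q ∷ w) =
  trans (cong₂ _+ℤ_ (ℤ.-1*i≡-i q) (dot-zeroˡ (All.map⁺ (All.tabulate⁺ (λ _ → refl))) w)) (ℤ.+-identityʳ (- q))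
dot-negUnit (suc i) (q ∷ w) = trans (ℤ.+-identityˡ _) (dot-negUnit i w)

mulVec-negId : ∀ k (w : Vec ℤ k) → mulVec (negId k) w ≡ tabulate (λ i → - lookup w i)
mulVec-negId k w = trans (sym (tabulate-∘ (λ row → dot row w) _)) (tabulate-cong (λ i → dot-negUnit i w))

mulVec-A : ∀ m (a : ℤ) (w : Vec ℤ (suc m)) →
  mulVec (A (suc (suc m))) (a ∷ w) ≡ tabulate (λ i → a - lookup w i) ++ mulVec (A (suc m)) w
mulVec-A m a w = begin
  mulVec (map (1ℤ ∷_) (negId (suc m)) ++ map (0ℤ ∷_) (A (suc m))) (a ∷ w)
    ≡⟨ mulVec-++ (map (1ℤ ∷_) (negId (suc m))) (map (0ℤ ∷_) (A (suc m))) (a ∷ w) ⟩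
  mulVec (map (1ℤ ∷_) (negId (suc m))) (a ∷ w) ++ mulVec (map (0ℤ ∷_) (A (suc m))) (a ∷ w)
    ≡⟨ cong₂ _++_ (mulVec-consCol 1ℤ (negId (suc m)) a w) (mulVec-consCol 0ℤ (A (suc m)) a w) ⟩
  map (1ℤ *ℤ a +ℤ_) (mulVec (negId (suc m)) w) ++ map (0ℤ *ℤ a +ℤ_) (mulVec (A (suc m)) w)
    ≡⟨ cong₂ _++_ differences (trans (map-cong ℤ.+-identityˡ _) (map-id _)) ⟩
  tabulate (λ i → a - lookup w i) ++ mulVec (A (suc m)) w ∎
  where
  differences : map (1ℤ *ℤ a +ℤ_) (mulVec (negId (suc m)) w) ≡ tabulate (λ i → a - lookup w i)
  differences = begin
    map (1ℤ *ℤ a +ℤ_) (mulVec (negId (suc m)) w)       ≡⟨ cong (map _) (mulVec-negId (suc m) w) ⟩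
    map (1ℤ *ℤ a +ℤ_) (tabulate (λ i → - lookup w i))  ≡⟨ tabulate-∘ _ (λ i → - lookup w i) ⟨
    tabulate (λ i → 1ℤ *ℤ a - lookup w i)              ≡⟨ tabulate-cong (λ i → cong (_- lookup w i) (ℤ.*-identityˡ a)) ⟩
    tabulate (λ i → a - lookup w i)                    ∎

differences-nonzero : ∀ {k} (a : ℤ) (f : Fin k → ℤ) → (∀ i → a - f i ≢ 0ℤ) ⇔ (∀ i → a ≢ f i)
differences-nonzero a f = mk⇔
  (λ h i a≡fi → h i (ℤ.i≡j⇒i-j≡0 a≡fi))
  (λ h i a-fi≡0 → h i (ℤ.i-j≡0⇒i≡j a (f i) a-fi≡0))

A-detects : ∀ n → DetectsRepetition (A n)
A-detects zero          []      = mk⇔ (λ _ ()) (λ _ → [])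
A-detects (suc zero)    w       = mk⇔ (λ _ → distinct-singleton (lookup w)) (λ _ → [])
A-detects (suc (suc m)) (a ∷ w) rewrite mulVec-A m a w =
  ⇔-trans (Nonvanishing-++ (tabulate (λ i → a - lookup w i)) (mulVec (A (suc m)) w))
    (⇔-trans (⇔-trans (mk⇔ All.tabulate⁻ All.tabulate⁺) (differences-nonzero a (lookup w)) ×-⇔ A-detects (suc m) w)
      (⇔-sym (Distinct-suc (lookup (a ∷ w)))))

lemma4p1 : (n : ℕ) → 1 ≤ n → (π τ : Permutation′ (n * n)) → (x : Vec ℤ (n * n)) →
    (All (λ z → z ≢ 0ℤ) (mulVec (permCols π (bigA n)) (permVec τ x))
      → ((j i i′ : Fin n) → i ≢ i′ →
           lookup x ((π ∘ₚ flip τ) ⟨$⟩ʳ combine j i)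
             ≢ lookup x ((π ∘ₚ flip τ) ⟨$⟩ʳ combine j i′)))
    × (((j i i′ : Fin n) → i ≢ i′ →
           lookup x ((π ∘ₚ flip τ) ⟨$⟩ʳ combine j i)
             ≢ lookup x ((π ∘ₚ flip τ) ⟨$⟩ʳ combine j i′))
      → All (λ z → z ≢ 0ℤ) (mulVec (permCols π (bigA n)) (permVec τ x)))
lemma4p1 n _ π τ x
  rewrite mulVec-permCols π (bigA n) (permVec τ x) =
  (λ nz → BlockDistinct-resp z≗x (to nz)) , (λ d → from (BlockDistinct-resp (sym ∘ z≗x) d))
  where
  z : Vec ℤ (n * n)
  z = permVec (flip π) (permVec τ x)
  z≗x : lookup z ≗ (λ c → lookup x ((π ∘ₚ flip τ) ⟨$⟩ʳ c))
  z≗x = lookup-permVec-permVec π τ x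
  open Equivalence (blockDiag-detects (A-detects n) n z)
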